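{- Let $G$ be a connected simple graph with a fixed total order on its edges, and let $T_1<\dots<T_k$ be its NBC spanning trees in lexicographic order. Suppose $i<j$, $f\in E(G)$, and $\mathcal{R}(T_i)\cup\{f\}\in[\mathcal{R}(T_j),T_j]$. Then $E(T_j)=(E(T_i)\setminus\{e\})\cup\{f\}$, where $e$ is the largest internally active edge of $T_i$ lying in the unique cycle of $T_i\cup f$. Moreover, $\mathcal{R}(T_i)\cup\{f\}=\mathcal{R}(T_j)$.
   Context: A broken circuit is the edge set of a cycle minus its smallest edge; an NBC spanning tree contains no broken circuit. Spanning trees are written as increasing tuples of edges and ordered lexicographically. For a spanning tree $T$ and $e\in E(T)$, $\mathrm{cut}(T,e)$ is the set of edges of $G$ joining the two components of $T-e$; $e$ is internally active if it is the smallest edge of $\mathrm{cut}(T,e)$. $\mathcal{R}(T_i)=\{x\in E(T_i): E(T_i)\setminus\{x\}\subseteq E(T_l)\text{ for some } l<i\}$. For edge sets $A\subseteq B$, $[A,B]$ is the set of edge sets $S$ with $A\subseteq S\subseteq B$. -}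

module Defs where

open import Data.Nat as ℕ using (ℕ; suc; _≥_)
open import Data.Nat.DivMod using (_%_; m%n<n)
open import Data.Fin as Fin using (Fin; toℕ; fromℕ<)
open import Data.Fin.Subset using (Subset; _∈_; _∉_; _⊆_; _∪_; _-_; ⁅_⁆; ⊤)
open import Data.Fin.Subset.Properties using (_∈?_)
open import Data.List using (List; filter; allFin)
open import Data.List.Relation.Binary.Lex.Strict using (Lex-<)
open import Data.Product using (Σ; ∃; ∃-syntax; _×_; _,_; proj₁; proj₂)
open import Data.Sum using (_⊎_)
open import Function.Definitions using (Injective)
open import Relation.Binary.PropositionalEquality using (_≡_; _≢_)
open import Relation.Nullary using (¬_)

-- Vertices are Fin n, edges are Fin m; the total order on edges is the
-- natural order of Fin m.  'ends g' are the two endpoints of edge g.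

record SimpleGraph : Set where
  field
    n      : ℕ
    m      : ℕ
    ends   : Fin m → Fin n × Fin n
    noLoop : ∀ g → proj₁ (ends g) ≢ proj₂ (ends g)
    noMulti : ∀ g h → proj₁ (ends g) ≡ proj₁ (ends h) × proj₂ (ends g) ≡ proj₂ (ends h)
                    ⊎ proj₁ (ends g) ≡ proj₂ (ends h) × proj₂ (ends g) ≡ proj₁ (ends h)
            → g ≡ h

module _ (G : SimpleGraph) where
  open SimpleGraph G

  EdgeSet : Set
  EdgeSet = Subset m

  Joins : Fin m → Fin n → Fin n → Set
  Joins g x y = (proj₁ (ends g) ≡ x × proj₂ (ends g) ≡ y)
              ⊎ (proj₁ (ends g) ≡ y × proj₂ (ends g) ≡ x)

  data Reach (S : EdgeSet) (u : Fin n) : Fin n → Set where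
    here : Reach S u u
    step : ∀ {x y} g → g ∈ S → Joins g x y → Reach S u x → Reach S u y

  ConnectedBy : EdgeSet → Set
  ConnectedBy S = ∀ u v → Reach S u v

  Connected : Set
  Connected = ConnectedBy ⊤

  cycSuc : ∀ {k} → Fin (suc k) → Fin (suc k)
  cycSuc {k} i = fromℕ< (m%n<n (suc (toℕ i)) (suc k))

  IsCycle : EdgeSet → Set
  IsCycle C = ∃[ k ] (suc k ≥ 3 × Σ (Fin (suc k) → Fin n) λ v → Σ (Fin (suc k) → Fin m) λ e →
                Injective _≡_ _≡_ v
              × (∀ t → Joins (e t) (v t) (v (cycSuc t)))
              × (∀ g → g ∈ C → ∃[ t ] e t ≡ g)
              × (∀ t → e t ∈ C))

  IsBrokenCircuit : EdgeSet → Set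
  IsBrokenCircuit B = ∃[ C ] ∃[ g ] (IsCycle C × g ∈ C × (∀ h → h ∈ C → g Fin.≤ h) × B ≡ C - g)

  SpanningTree : EdgeSet → Set
  SpanningTree T = ConnectedBy T × (∀ C → IsCycle C → ¬ (C ⊆ T))

  NBC : EdgeSet → Set
  NBC T = ∀ B → IsBrokenCircuit B → ¬ (B ⊆ T)

  NBCSpanningTree : EdgeSet → Set
  NBCSpanningTree T = SpanningTree T × NBC T

  elems : EdgeSet → List (Fin m)
  elems S = filter (_∈? S) (allFin m)

  _<lex_ : EdgeSet → EdgeSet → Set
  S <lex T = Lex-< _≡_ Fin._<_ (elems S) (elems T)

  -- g ∈ cut(T,e): g joins the two components of T - e
  InCut : EdgeSet → Fin m → Fin m → Set
  InCut T e g = ¬ Reach (T - e) (proj₁ (ends g)) (proj₂ (ends g))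

  InternallyActive : EdgeSet → Fin m → Set
  InternallyActive T e = e ∈ T × (∀ g → InCut T e g → e Fin.≤ g)

  InR : EdgeSet → Fin m → Set
  InR T x = x ∈ T × ∃[ T' ] (NBCSpanningTree T' × T' <lex T × (T - x) ⊆ T')

  ℛ : EdgeSet → Fin m → Set
  ℛ T = InR T

  _∪₁_ : (Fin m → Set) → Fin m → Fin m → Set
  (P ∪₁ f) x = P x ⊎ x ≡ f

  -- A ∈ [B , T] for the interval of edge sets (B, A predicates, T a subset)
  InInterval : (Fin m → Set) → (Fin m → Set) → EdgeSet → Set
  InInterval A B T = (∀ x → B x → A x) × (∀ x → A x → x ∈ T)

  _≐_ : (Fin m → Set) → (Fin m → Set) → Set
  A ≐ B = ∀ x → (A x → B x) × (B x → A x)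

module Submission where

-- Call x ∈ T passive if some smaller edge lies in cut(T, x), i.e. if x is not internally active.
-- The passive edges of an NBC tree T are exactly ℛ(T): exchanging a passive x for the least edge
-- of its cut gives a lexicographically earlier NBC tree containing T - x, and conversely the first
-- edge where such an earlier tree differs from T lies in cut(T, x) below x.
--
-- Let g be the first edge where Tᵢ and Tⱼ differ (g ∈ Tᵢ ∖ Tⱼ) and C the fundamental cycle of g in
-- Tⱼ. Each edge of C outside Tᵢ has g in its Tⱼ-cut, so it is passive in Tⱼ, lies in
-- ℛ(Tⱼ) ⊆ ℛ(Tᵢ) ∪ {f}, and must be f. Each other edge y of Tᵢ stays in Tⱼ: otherwise the
-- fundamental cycle of y in Tⱼ would supply a passive edge of Tⱼ in cut(Tᵢ, y), again forcing it to
-- be f, while f ∉ cut(Tᵢ, y) unless y ∈ C. So Tⱼ = Tᵢ - g + f; g is active because passive edges of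
-- Tᵢ survive in Tⱼ, and any active edge of C above g would be passive in Tⱼ. Finally the passive
-- edges of Tᵢ stay passive in Tⱼ, which gives ℛ(Tᵢ) ∪ {f} = ℛ(Tⱼ).

open import Defs
open import Data.Nat as ℕ using (ℕ; zero; suc; _+_; _*_; _∸_; z≤n; s≤s; NonZero)
import Data.Nat.Properties as ℕ
open import Data.Nat.DivMod using (_%_; _/_; m%n<n; m<n⇒m%n≡m; n%n≡0; %-distribˡ-+; m%n%n≡m%n; m≡m%n+[m/n]*n; [m+n]%n≡m%n)
open import Data.Fin as Fin using (Fin; zero; suc; toℕ; fromℕ<; fromℕ; inject₁; _≟_; _<_; _≤_)
import Data.Fin.Properties as Fin
open import Data.Fin.Subset using (Subset; _∈_; _∉_; _∪_; _─_; _-_; ⁅_⁆; _⊆_; inside; outside)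
open import Data.Fin.Subset.Properties using (_∈?_; drop-there; x∈⁅x⁆; x∈⁅y⁆⇒x≡y; x∈p∪q⁻; x∈p∪q⁺; x∈p∧x≢y⇒x∈p-y; p─q⊆p; ⊆-antisym)
open import Data.Vec using ([]; _∷_; here; there)
open import Data.List using (List; []; _∷_; filter; allFin; map; tabulate)
open import Data.List.Relation.Binary.Lex.Strict using (Lex-<)
open import Data.List.Relation.Binary.Lex.Core using (base; halt; this; next)
open import Data.Product using (∃; ∃-syntax; _×_; _,_; proj₁; proj₂)
open import Data.Sum using (_⊎_; inj₁; inj₂; [_,_]′)
open import Data.Empty using (⊥; ⊥-elim)
open import Function using (_∘_; id)
open import Relation.Binary.PropositionalEquality using (_≡_; _≢_; refl; sym; trans; cong; subst; module ≡-Reasoning)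
open import Function.Definitions using (Injective)
open import Relation.Nullary using (¬_; Dec; yes; no; does)
open import Relation.Binary using (tri<; tri≈; tri>)
open import Relation.Nullary.Decidable using (map′; _×-dec_; _⊎-dec_; ¬?)
open import Relation.Unary using (Decidable)

-- Subsets of Fin k and their lexicographic order

x∈p─q⇒x∉q : ∀ {k} {p q : Subset k} {x} → x ∈ p ─ q → x ∉ q
x∈p─q⇒x∉q {p = s ∷ p} {inside  ∷ q} ()   here
x∈p─q⇒x∉q {p = s ∷ p} {outside ∷ q} here ()
x∈p─q⇒x∉q {p = s ∷ p} {t ∷ q}       (there x∈p─q) (there x∈q) = x∈p─q⇒x∉q x∈p─q x∈q

module _ {k : ℕ} where

  x∈p-y⇒x∈p : ∀ {p : Subset k} {x y} → x ∈ p - y → x ∈ p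
  x∈p-y⇒x∈p {p} {y = y} = p─q⊆p p ⁅ y ⁆

  x∈p-y⇒x≢y : ∀ {p : Subset k} {x y} → x ∈ p - y → x ≢ y
  x∈p-y⇒x≢y x∈ refl = x∈p─q⇒x∉q x∈ (x∈⁅x⁆ _)

  x∈p⇒x∈p-y⊎x≡y : ∀ {p : Subset k} {x} y → x ∈ p → x ∈ p - y ⊎ x ≡ y
  x∈p⇒x∈p-y⊎x≡y {x = x} y x∈p with x ≟ y
  ... | yes x≡y = inj₂ x≡y
  ... | no  x≢y = inj₁ (x∈p∧x≢y⇒x∈p-y x∈p x≢y)

  x∈p∪⁅y⁆⁻ : ∀ {p : Subset k} {x y} → x ∈ p ∪ ⁅ y ⁆ → x ∈ p ⊎ x ≡ y
  x∈p∪⁅y⁆⁻ {p} {y = y} x∈ with x∈p∪q⁻ p ⁅ y ⁆ x∈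
  ... | inj₁ x∈p = inj₁ x∈p
  ... | inj₂ x∈y = inj₂ (x∈⁅y⁆⇒x≡y y x∈y)

  x∈p∪⁅y⁆⁺ : ∀ {p : Subset k} {x y} → x ∈ p ⊎ x ≡ y → x ∈ p ∪ ⁅ y ⁆
  x∈p∪⁅y⁆⁺ (inj₁ x∈p) = x∈p∪q⁺ (inj₁ x∈p)
  x∈p∪⁅y⁆⁺ (inj₂ refl) = x∈p∪q⁺ (inj₂ (x∈⁅x⁆ _))

  elements : Subset k → List (Fin k)
  elements S = filter (_∈? S) (allFin k)

  AgreeBelow : Subset k → Subset k → Fin k → Set
  AgreeBelow S U d = ∀ z → z < d → (z ∈ S → z ∈ U) × (z ∈ U → z ∈ S)

  -- S <lex U: either S and U first differ at some d ∈ S ∖ U, or S ⊊ U.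
  LexDifference : Subset k → Subset k → Set
  LexDifference S U = (∃[ d ] (d ∈ S × d ∉ U × AgreeBelow S U d))
                    ⊎ (S ⊆ U × ∃[ y ] (y ∈ U × y ∉ S))

infix 4 _<ˡ_
_<ˡ_ : ∀ {k} → List (Fin k) → List (Fin k) → Set
_<ˡ_ = Lex-< _≡_ _<_

private

  filter-suc : ∀ {k j} b (S : Subset k) (f : Fin j → Fin k) →
    filter (_∈? (b ∷ S)) (tabulate (suc ∘ f)) ≡ map suc (filter (_∈? S) (tabulate f))
  filter-suc {j = zero}  b S f = refl
  filter-suc {j = suc j} b S f with f zero ∈? S
  ... | yes _ = cong (suc (f zero) ∷_) (filter-suc b S (f ∘ suc))
  ... | no  _ = filter-suc b S (f ∘ suc)

  elements-inside : ∀ {k} (S : Subset k) → elements (inside ∷ S) ≡ zero ∷ map suc (elements S)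
  elements-inside S = cong (zero ∷_) (filter-suc inside S id)

  elements-outside : ∀ {k} (S : Subset k) → elements (outside ∷ S) ≡ map suc (elements S)
  elements-outside S = filter-suc outside S id

  elements-nonEmpty : ∀ {k} (S : Subset k) {z} → z ∈ S → ∃[ a ] ∃[ as ] elements S ≡ a ∷ as
  elements-nonEmpty (inside ∷ S) here = _ , _ , elements-inside S
  elements-nonEmpty (inside ∷ S) (there _) = _ , _ , elements-inside S
  elements-nonEmpty (outside ∷ S) (there z∈S) with elements-nonEmpty S z∈S
  ... | a , as , eq = suc a , map suc as , trans (elements-outside S) (cong (map suc) eq)

  elements-[] : ∀ {k} (S : Subset k) → elements S ≡ [] → ∀ z → z ∉ S
  elements-[] S eq z z∈S with elements-nonEmpty S z∈S
  ... | a , as , eq′ with trans (sym eq) eq′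
  ... | ()

  map-suc-<ˡ⁺ : ∀ {k} {xs ys : List (Fin k)} → xs <ˡ ys → map suc xs <ˡ map suc ys
  map-suc-<ˡ⁺ (base ())
  map-suc-<ˡ⁺ halt          = halt
  map-suc-<ˡ⁺ (this x<y)    = this (s≤s x<y)
  map-suc-<ˡ⁺ (next refl l) = next refl (map-suc-<ˡ⁺ l)

  map-suc-<ˡ⁻ : ∀ {k} {xs ys : List (Fin k)} → map suc xs <ˡ map suc ys → xs <ˡ ys
  map-suc-<ˡ⁻ {xs = []}     {[]}     (base ())
  map-suc-<ˡ⁻ {xs = []}     {y ∷ ys} halt                = halt
  map-suc-<ˡ⁻ {xs = x ∷ xs} {y ∷ ys} (this (s≤s x<y))    = this x<y
  map-suc-<ˡ⁻ {xs = x ∷ xs} {y ∷ ys} (next refl l)       = next refl (map-suc-<ˡ⁻ l)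

  zero∷-<ˡ⁻ : ∀ {k} {xs ys : List (Fin k)} → zero ∷ map suc xs <ˡ zero ∷ map suc ys → xs <ˡ ys
  zero∷-<ˡ⁻ (this ())
  zero∷-<ˡ⁻ (next refl l) = map-suc-<ˡ⁻ l

  map-suc-<ˡ-zero∷ : ∀ {k} {xs : List (Fin k)} {ys} → map suc xs <ˡ zero ∷ ys → xs ≡ []
  map-suc-<ˡ-zero∷ {xs = []}    _         = refl
  map-suc-<ˡ-zero∷ {xs = _ ∷ _} (this ())
  map-suc-<ˡ-zero∷ {xs = _ ∷ _} (next () _)

  lexDifference-∷ : ∀ {k} s {S U : Subset k} → LexDifference S U → LexDifference (s ∷ S) (s ∷ U)
  lexDifference-∷ s {S} {U} (inj₁ (d , d∈S , d∉U , agree)) =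
    inj₁ (suc d , there d∈S , d∉U ∘ drop-there , agree′)
    where
    agree′ : AgreeBelow (s ∷ S) (s ∷ U) (suc d)
    agree′ zero    _         = (λ { here → here }) , (λ { here → here })
    agree′ (suc z) (s≤s z<d) = (there ∘ proj₁ (agree z z<d) ∘ drop-there)
                             , (there ∘ proj₂ (agree z z<d) ∘ drop-there)
  lexDifference-∷ s {S} {U} (inj₂ (S⊆U , y , y∈U , y∉S)) =
    inj₂ (S⊆U′ , suc y , there y∈U , y∉S ∘ drop-there)
    where
    S⊆U′ : s ∷ S ⊆ s ∷ U
    S⊆U′ here       = here
    S⊆U′ (there z∈) = there (S⊆U z∈)

  agreeBelow-drop : ∀ {k} {s u} {S U : Subset k} {d} → AgreeBelow (s ∷ S) (u ∷ U) (suc d) → AgreeBelow S U d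
  agreeBelow-drop agree z z<d = (drop-there ∘ proj₁ (agree (suc z) (s≤s z<d)) ∘ there)
                              , (drop-there ∘ proj₂ (agree (suc z) (s≤s z<d)) ∘ there)

<lex⇒lexDifference : ∀ {k} (S U : Subset k) → elements S <ˡ elements U → LexDifference S U
<lex⇒lexDifference [] [] (base ())
<lex⇒lexDifference (inside ∷ S) (inside ∷ U) l rewrite elements-inside S | elements-inside U =
  lexDifference-∷ inside (<lex⇒lexDifference S U (zero∷-<ˡ⁻ l))
<lex⇒lexDifference (outside ∷ S) (outside ∷ U) l rewrite elements-outside S | elements-outside U =
  lexDifference-∷ outside (<lex⇒lexDifference S U (map-suc-<ˡ⁻ l))
<lex⇒lexDifference (inside ∷ S) (outside ∷ U) l = inj₁ (zero , here , (λ ()) , λ _ ())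
<lex⇒lexDifference (outside ∷ S) (inside ∷ U) l rewrite elements-outside S | elements-inside U =
  inj₂ (S⊆U , zero , here , λ ())
  where
  S⊆U : outside ∷ S ⊆ inside ∷ U
  S⊆U {suc z} (there z∈S) = ⊥-elim (elements-[] S (map-suc-<ˡ-zero∷ l) z z∈S)

firstDifference⇒<lex : ∀ {k} (S U : Subset k) d → d ∈ S → d ∉ U → AgreeBelow S U d →
                       ∃[ y ] (y ∈ U × d < y) → elements S <ˡ elements U
firstDifference⇒<lex (inside ∷ S) (outside ∷ U) zero here _ _ (suc y , there y∈U , _)
  with elements-nonEmpty U y∈U
... | _ , _ , eq rewrite elements-inside S | elements-outside U | eq = this (s≤s z≤n)
firstDifference⇒<lex (inside ∷ S) (inside ∷ U) zero here d∉U _ _ = ⊥-elim (d∉U here)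
firstDifference⇒<lex (inside ∷ S) (inside ∷ U) (suc d) (there d∈S) d∉U agree (suc y , there y∈U , s≤s d<y)
  rewrite elements-inside S | elements-inside U =
  next refl (map-suc-<ˡ⁺ (firstDifference⇒<lex S U d d∈S (d∉U ∘ there) (agreeBelow-drop agree) (y , y∈U , d<y)))
firstDifference⇒<lex (outside ∷ S) (outside ∷ U) (suc d) (there d∈S) d∉U agree (suc y , there y∈U , s≤s d<y)
  rewrite elements-outside S | elements-outside U =
  map-suc-<ˡ⁺ (firstDifference⇒<lex S U d d∈S (d∉U ∘ there) (agreeBelow-drop agree) (y , y∈U , d<y))
firstDifference⇒<lex (inside ∷ S) (outside ∷ U) (suc d) _ _ agree _ with proj₁ (agree zero (s≤s z≤n)) here
... | ()
firstDifference⇒<lex (outside ∷ S) (inside ∷ U) (suc d) _ _ agree _ with proj₂ (agree zero (s≤s z≤n)) here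
... | ()

exchange-<lex : ∀ {k} {T : Subset k} {x g} → x ∈ T → g ∉ T → g < x → elements ((T - x) ∪ ⁅ g ⁆) <ˡ elements T
exchange-<lex {T = T} {x} {g} x∈T g∉T g<x =
  firstDifference⇒<lex ((T - x) ∪ ⁅ g ⁆) T g (x∈p∪⁅y⁆⁺ (inj₂ refl)) g∉T agree (x , x∈T , g<x)
  where
  agree : AgreeBelow ((T - x) ∪ ⁅ g ⁆) T g
  agree z z<g = [ x∈p-y⇒x∈p , (λ { refl → ⊥-elim (Fin.<-irrefl refl z<g) }) ]′ ∘ x∈p∪⁅y⁆⁻
              , λ z∈T → x∈p∪⁅y⁆⁺ (inj₁ (x∈p∧x≢y⇒x∈p-y z∈T (λ { refl → Fin.<-asym z<g g<x })))

subsetOf : ∀ {k} {Q : Fin k → Set} → Decidable Q → Subset k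
subsetOf {zero}  _  = []
subsetOf {suc k} Q? = does (Q? zero) ∷ subsetOf (Q? ∘ suc)

∈subsetOf⁺ : ∀ {k} {Q : Fin k → Set} (Q? : Decidable Q) {x} → Q x → x ∈ subsetOf Q?
∈subsetOf⁺ Q? {zero} q with Q? zero
... | yes _  = here
... | no ¬q = ⊥-elim (¬q q)
∈subsetOf⁺ Q? {suc x} q = there (∈subsetOf⁺ (Q? ∘ suc) q)

∈subsetOf⁻ : ∀ {k} {Q : Fin k → Set} (Q? : Decidable Q) {x} → x ∈ subsetOf Q? → Q x
∈subsetOf⁻ Q? {zero} x∈ with Q? zero | x∈
... | yes q | _ = q
... | no _  | ()
∈subsetOf⁻ Q? {suc x} (there x∈) = ∈subsetOf⁻ (Q? ∘ suc) x∈

leastWitness : ∀ {k} {Q : Fin k → Set} → Decidable Q → ∃ Q → ∃[ x ] (Q x × ∀ y → Q y → x ≤ y)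
leastWitness {suc k} {Q} Q? (w , qw) with Q? zero
... | yes q₀ = zero , q₀ , λ _ _ → z≤n
... | no ¬q₀ with w
...   | zero  = ⊥-elim (¬q₀ qw)
...   | suc w′ with leastWitness (Q? ∘ suc) (w′ , qw)
...     | x , qx , least = suc x , qx , least′
  where
  least′ : ∀ y → Q y → suc x ≤ y
  least′ zero    qy = ⊥-elim (¬q₀ qy)
  least′ (suc y) qy = s≤s (least y qy)

[1+m%n]%n≡[1+m]%n : ∀ m n .{{_ : NonZero n}} → suc (m % n) % n ≡ suc m % n
[1+m%n]%n≡[1+m]%n m n = trans (%-distribˡ-+ 1 (m % n) n)
  (trans (cong (λ z → (1 % n + z) % n) (m%n%n≡m%n m n)) (sym (%-distribˡ-+ 1 m n)))

[m+o]%n≢m : ∀ m o n .{{_ : NonZero n}} → 0 ℕ.< o → o ℕ.< n → (m + o) % n ≢ m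
[m+o]%n≢m m o n 0<o o<n eq = notMultiple ((m + o) / n) o≡qn
  where
  o≡qn : o ≡ ((m + o) / n) * n
  o≡qn = ℕ.+-cancelˡ-≡ m _ _ (trans (m≡m%n+[m/n]*n (m + o) n) (cong (_+ ((m + o) / n) * n) eq))

  notMultiple : ∀ q → o ≢ q * n
  notMultiple zero    o≡0   = ℕ.<-irrefl (sym o≡0) 0<o
  notMultiple (suc q) o≡qn′ = ℕ.<-irrefl refl (ℕ.<-≤-trans o<n (subst (n ℕ.≤_) (sym o≡qn′) (ℕ.m≤m+n n (q * n))))

module Graph (G : SimpleGraph) where
  open SimpleGraph G

  Vertex Edge : Set
  Vertex = Fin n
  Edge   = Fin m

  end₁ end₂ : Edge → Vertex
  end₁ g = proj₁ (ends g)
  end₂ g = proj₂ (ends g)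

  joins-ends : ∀ g → Joins G g (end₁ g) (end₂ g)
  joins-ends g = inj₁ (refl , refl)

  Joins-sym : ∀ {g x y} → Joins G g x y → Joins G g y x
  Joins-sym (inj₁ (a , b)) = inj₂ (a , b)
  Joins-sym (inj₂ (a , b)) = inj₁ (a , b)

  Joins-unique : ∀ {g a b c d} → Joins G g a b → Joins G g c d → (a ≡ c × b ≡ d) ⊎ (a ≡ d × b ≡ c)
  Joins-unique (inj₁ (refl , refl)) (inj₁ (refl , refl)) = inj₁ (refl , refl)
  Joins-unique (inj₁ (refl , refl)) (inj₂ (refl , refl)) = inj₂ (refl , refl)
  Joins-unique (inj₂ (refl , refl)) (inj₁ (refl , refl)) = inj₂ (refl , refl)
  Joins-unique (inj₂ (refl , refl)) (inj₂ (refl , refl)) = inj₁ (refl , refl)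

  -- Walks

  -- Unlike Reach, walks are built from the front and restricted by an arbitrary edge predicate.
  data Walk (P : Edge → Set) : Vertex → Vertex → Set where
    []   : ∀ {x} → Walk P x x
    cons : ∀ {x y z} g → P g → Joins G g x y → Walk P y z → Walk P x z

  module _ {P : Edge → Set} where

    snoc : ∀ {x y z} → Walk P x y → ∀ g → P g → Joins G g y z → Walk P x z
    snoc []               g p j = cons g p j []
    snoc (cons h q j′ w) g p j = cons h q j′ (snoc w g p j)

    _++_ : ∀ {x y z} → Walk P x y → Walk P y z → Walk P x z
    []              ++ w′ = w′
    cons g p j w   ++ w′ = cons g p j (w ++ w′)

    reverse : ∀ {x y} → Walk P x y → Walk P y x
    reverse []             = []
    reverse (cons g p j w) = snoc (reverse w) g p (Joins-sym j)

    edgeWalk : ∀ g → P g → Walk P (end₁ g) (end₂ g)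
    edgeWalk g p = cons g p (joins-ends g) []

    alongEdge : ∀ {h x y} → Joins G h x y → Walk P (end₁ h) (end₂ h) → Walk P x y
    alongEdge (inj₁ (refl , refl)) w = w
    alongEdge (inj₂ (refl , refl)) w = reverse w

    alongEdge⁻ : ∀ {h x y} → Joins G h x y → Walk P x y → Walk P (end₁ h) (end₂ h)
    alongEdge⁻ (inj₁ (refl , refl)) w = w
    alongEdge⁻ (inj₂ (refl , refl)) w = reverse w

  weaken : ∀ {P Q : Edge → Set} → (∀ g → P g → Q g) → ∀ {x y} → Walk P x y → Walk Q x y
  weaken P⇒Q []             = []
  weaken P⇒Q (cons g p j w) = cons g (P⇒Q g p) j (weaken P⇒Q w)

  reach⇒walk : ∀ {S u v} → Reach G S u v → Walk (_∈ S) u v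
  reach⇒walk here             = []
  reach⇒walk (step g g∈S j r) = snoc (reach⇒walk r) g g∈S j

  walk⇒reach : ∀ {S u v} → Walk (_∈ S) u v → Reach G S u v
  walk⇒reach = go here
    where
    go : ∀ {S u x v} → Reach G S u x → Walk (_∈ S) x v → Reach G S u v
    go r []             = r
    go r (cons g p j w) = go (step g p j r) w

  bypass : ∀ {P Q : Edge → Set} h → (∀ g → P g → Q g ⊎ g ≡ h) → Walk Q (end₁ h) (end₂ h) →
           ∀ {x y} → Walk P x y → Walk Q x y
  bypass h P⇒Q wh []             = []
  bypass h P⇒Q wh (cons g p j w) with P⇒Q g p
  ... | inj₁ q    = cons g q j (bypass h P⇒Q wh w)
  ... | inj₂ refl = alongEdge j wh ++ bypass h P⇒Q wh w

  ThroughEdge : (Edge → Set) → Edge → Vertex → Vertex → Set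
  ThroughEdge Q h u v = Walk Q u v
                      ⊎ (Walk Q u (end₁ h) × Walk Q (end₂ h) v)
                      ⊎ (Walk Q u (end₂ h) × Walk Q (end₁ h) v)

  -- Keep the parts before the first and after the last traversal of h.
  splitAt : ∀ {P Q : Edge → Set} h → (∀ g → P g → Q g ⊎ g ≡ h) → ∀ {u v} → Walk P u v → ThroughEdge Q h u v
  splitAt h P⇒Q [] = inj₁ []
  splitAt h P⇒Q (cons g p j w) with P⇒Q g p | splitAt h P⇒Q w
  ... | inj₁ q | inj₁ w′               = inj₁ (cons g q j w′)
  ... | inj₁ q | inj₂ (inj₁ (a , b))  = inj₂ (inj₁ (cons g q j a , b))
  ... | inj₁ q | inj₂ (inj₂ (a , b))  = inj₂ (inj₂ (cons g q j a , b))
  splitAt h P⇒Q (cons .h p (inj₁ (refl , refl)) w) | inj₂ refl | inj₁ w′              = inj₂ (inj₁ ([] , w′))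
  splitAt h P⇒Q (cons .h p (inj₂ (refl , refl)) w) | inj₂ refl | inj₁ w′              = inj₂ (inj₂ ([] , w′))
  splitAt h P⇒Q (cons .h p (inj₁ (refl , refl)) w) | inj₂ refl | inj₂ (inj₁ (_ , b)) = inj₂ (inj₁ ([] , b))
  splitAt h P⇒Q (cons .h p (inj₂ (refl , refl)) w) | inj₂ refl | inj₂ (inj₁ (_ , b)) = inj₁ b
  splitAt h P⇒Q (cons .h p (inj₁ (refl , refl)) w) | inj₂ refl | inj₂ (inj₂ (_ , b)) = inj₁ b
  splitAt h P⇒Q (cons .h p (inj₂ (refl , refl)) w) | inj₂ refl | inj₂ (inj₂ (_ , b)) = inj₂ (inj₂ ([] , b))

  joinAt : ∀ {P Q : Edge → Set} h → (∀ g → Q g → P g) → P h → ∀ {u v} → ThroughEdge Q h u v → Walk P u v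
  joinAt h Q⇒P ph (inj₁ w)             = weaken Q⇒P w
  joinAt h Q⇒P ph (inj₂ (inj₁ (a , b))) = weaken Q⇒P a ++ cons h ph (joins-ends h) (weaken Q⇒P b)
  joinAt h Q⇒P ph (inj₂ (inj₂ (a , b))) = weaken Q⇒P a ++ cons h ph (Joins-sym (joins-ends h)) (weaken Q⇒P b)

  Separates : (Vertex → Set) → Edge → Set
  Separates Q g = (Q (end₁ g) × ¬ Q (end₂ g)) ⊎ (¬ Q (end₁ g) × Q (end₂ g))

  exitEdge : ∀ {P : Edge → Set} (Q : Vertex → Set) → Decidable Q → ∀ {a b} → Walk P a b → Q a → ¬ Q b →
             ∃[ g ] (P g × Separates Q g)
  exitEdge Q Q? [] qa ¬qb = ⊥-elim (¬qb qa)
  exitEdge Q Q? (cons {y = y} g p j w) qa ¬qb with Q? y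
  ... | yes qy = exitEdge Q Q? w qy ¬qb
  exitEdge Q Q? (cons g p (inj₁ (refl , refl)) w) qa ¬qb | no ¬qy = g , p , inj₁ (qa , ¬qy)
  exitEdge Q Q? (cons g p (inj₂ (refl , refl)) w) qa ¬qb | no ¬qy = g , p , inj₂ (¬qy , qa)

  -- Decide walks by induction on the number of edges admitted, in the order of Fin m.
  private
    Below : (Edge → Set) → ℕ → Edge → Set
    Below P k g = P g × toℕ g ℕ.< k

    below-suc : ∀ {P k} (k<m : k ℕ.< m) g → Below P (suc k) g → Below P k g ⊎ g ≡ fromℕ< k<m
    below-suc k<m g (pg , g<1+k) with ℕ.m≤n⇒m<n∨m≡n (ℕ.s≤s⁻¹ g<1+k)
    ... | inj₁ g<k = inj₁ (pg , g<k)
    ... | inj₂ g≡k = inj₂ (Fin.toℕ-injective (trans g≡k (sym (Fin.toℕ-fromℕ< k<m))))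

    below-weaken : ∀ {P k} g → Below P k g → Below P (suc k) g
    below-weaken g (pg , g<k) = pg , ℕ.m≤n⇒m≤1+n g<k

    walkBelow-zero : ∀ {P u v} → Walk (Below P 0) u v → u ≡ v
    walkBelow-zero []                  = refl
    walkBelow-zero (cons _ (_ , ()) _ _)

    walkBelow? : ∀ {P : Edge → Set} → Decidable P → ∀ k → k ℕ.≤ m → ∀ u v → Dec (Walk (Below P k) u v)
    walkBelow? P? zero _ u v = map′ (λ { refl → [] }) walkBelow-zero (u ≟ v)
    walkBelow? {P} P? (suc k) k<m u v with P? (fromℕ< k<m)
    ... | no ¬ph = map′ (weaken below-weaken) (weaken avoid) (walkBelow? P? k (ℕ.<⇒≤ k<m) u v)
      where
      avoid : ∀ g → Below P (suc k) g → Below P k g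
      avoid g b with below-suc {P} k<m g b
      ... | inj₁ b′   = b′
      ... | inj₂ refl = ⊥-elim (¬ph (proj₁ b))
    ... | yes ph = map′ (joinAt h below-weaken (ph , s≤s (ℕ.≤-reflexive (Fin.toℕ-fromℕ< k<m))))
                        (splitAt h (below-suc k<m))
                        (W u v ⊎-dec W u (end₁ h) ×-dec W (end₂ h) v ⊎-dec W u (end₂ h) ×-dec W (end₁ h) v)
      where
      h : Edge
      h = fromℕ< k<m

      W : ∀ u v → Dec (Walk (Below P k) u v)
      W = walkBelow? P? k (ℕ.<⇒≤ k<m)

  walk? : ∀ {P : Edge → Set} → Decidable P → ∀ u v → Dec (Walk P u v)
  walk? P? u v = map′ (weaken (λ _ → proj₁)) (weaken (λ g p → p , Fin.toℕ<n g)) (walkBelow? P? m ℕ.≤-refl u v)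

  -- Paths and cycles

  mutual
    data Path (P : Edge → Set) : Vertex → Vertex → ℕ → Set where
      []   : ∀ {x} → Path P x x 0
      cons : ∀ {x y z k} g → P g → Joins G g x y → (p : Path P y z k) → (∀ i → vertex p i ≢ x) →
             Path P x z (suc k)

    vertex : ∀ {P x z k} → Path P x z k → Fin (suc k) → Vertex
    vertex {x = x} []                 zero    = x
    vertex {x = x} (cons _ _ _ _ _)   zero    = x
    vertex         (cons _ _ _ p _)   (suc i) = vertex p i

  -- Position k, one past the last edge, holds the closing edge c.
  edgeClosedBy : ∀ {P x z k} → Path P x z k → Edge → Fin (suc k) → Edge
  edgeClosedBy []               c zero    = c
  edgeClosedBy (cons g _ _ _ _) c zero    = g
  edgeClosedBy (cons _ _ _ p _) c (suc i) = edgeClosedBy p c i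

  module _ {P : Edge → Set} where

    suffixFrom : ∀ {y z k} (p : Path P y z k) → ∀ {x} i → vertex p i ≡ x → ∃[ k′ ] Path P x z k′
    suffixFrom []                   zero    refl = 0 , []
    suffixFrom (cons g pg j p fresh) zero    refl = _ , cons g pg j p fresh
    suffixFrom (cons _ _ _ p _)      (suc i) eq   = suffixFrom p i eq

    -- Loop erasure: cut the walk back to the last visit of its first vertex.
    walk⇒path : ∀ {x z} → Walk P x z → ∃[ k ] Path P x z k
    walk⇒path [] = 0 , []
    walk⇒path {x} (cons g pg j w) with walk⇒path w
    ... | k , p with Fin.any? (λ i → vertex p i ≟ x)
    ...   | yes (i , eq) = suffixFrom p i eq
    ...   | no fresh     = suc k , cons g pg j p (λ i e → fresh (i , e))

    vertex-injective : ∀ {x z k} (p : Path P x z k) → ∀ {i j} → vertex p i ≡ vertex p j → i ≡ j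
    vertex-injective []                    {zero}  {zero}  _  = refl
    vertex-injective (cons _ _ _ _ _)      {zero}  {zero}  _  = refl
    vertex-injective (cons _ _ _ _ fresh)  {zero}  {suc j} eq = ⊥-elim (fresh j (sym eq))
    vertex-injective (cons _ _ _ _ fresh)  {suc i} {zero}  eq = ⊥-elim (fresh i eq)
    vertex-injective (cons _ _ _ p _)      {suc i} {suc j} eq = cong suc (vertex-injective p eq)

    vertex-first : ∀ {x z k} (p : Path P x z k) → vertex p zero ≡ x
    vertex-first []               = refl
    vertex-first (cons _ _ _ _ _) = refl

    vertex-last : ∀ {x z k} (p : Path P x z k) → vertex p (fromℕ k) ≡ z
    vertex-last []               = refl
    vertex-last (cons _ _ _ p _) = vertex-last p

    edgeClosedBy-last : ∀ {x z k} (p : Path P x z k) c → edgeClosedBy p c (fromℕ k) ≡ c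
    edgeClosedBy-last []               c = refl
    edgeClosedBy-last (cons _ _ _ p _) c = edgeClosedBy-last p c

    edgeClosedBy-joins : ∀ {x z k} (p : Path P x z k) c (i : Fin k) →
                         Joins G (edgeClosedBy p c (inject₁ i)) (vertex p (inject₁ i)) (vertex p (suc i))
    edgeClosedBy-joins (cons g _ j p _) c zero    = subst (Joins G g _) (sym (vertex-first p)) j
    edgeClosedBy-joins (cons _ _ _ p _) c (suc i) = edgeClosedBy-joins p c i

    edgeClosedBy-pred : ∀ {x z k} (p : Path P x z k) c i → P (edgeClosedBy p c i) ⊎ edgeClosedBy p c i ≡ c
    edgeClosedBy-pred []                c zero    = inj₂ refl
    edgeClosedBy-pred (cons _ pg _ _ _) c zero    = inj₁ pg
    edgeClosedBy-pred (cons _ _ _ p _)  c (suc i) = edgeClosedBy-pred p c i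

  fromℕ-or-inject₁ : ∀ {k} (t : Fin (suc k)) → t ≡ fromℕ k ⊎ ∃[ t′ ] t ≡ inject₁ t′
  fromℕ-or-inject₁ {zero}  zero    = inj₁ refl
  fromℕ-or-inject₁ {suc k} zero    = inj₂ (zero , refl)
  fromℕ-or-inject₁ {suc k} (suc t) with fromℕ-or-inject₁ t
  ... | inj₁ eq        = inj₁ (cong suc eq)
  ... | inj₂ (t′ , eq) = inj₂ (suc t′ , cong suc eq)

  cycSuc-inject₁ : ∀ {k} (t : Fin k) → cycSuc G (inject₁ t) ≡ suc t
  cycSuc-inject₁ {k} t = Fin.toℕ-injective (trans (Fin.toℕ-fromℕ< (m%n<n (suc (toℕ (inject₁ t))) (suc k)))
    (trans (cong (λ z → suc z % suc k) (Fin.toℕ-inject₁ t)) (m<n⇒m%n≡m (s≤s (Fin.toℕ<n t)))))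

  cycSuc-fromℕ : ∀ k → cycSuc G (fromℕ k) ≡ zero
  cycSuc-fromℕ k = Fin.toℕ-injective (trans (Fin.toℕ-fromℕ< (m%n<n (suc (toℕ (fromℕ k))) (suc k)))
    (trans (cong (λ z → suc z % suc k) (Fin.toℕ-fromℕ k)) (n%n≡0 (suc k))))

  CycleThrough : (Edge → Set) → Edge → Set
  CycleThrough P h = ∃[ C ] (IsCycle G C × (∀ x → x ∈ C → P x ⊎ x ≡ h) × h ∈ C)

  closePath : ∀ {P : Edge → Set} {a b k} (p : Path P a b (suc (suc k))) h → Joins G h b a → CycleThrough P h
  closePath {P} {a} {b} {k} p h jh =
    C , (suc (suc k) , s≤s (s≤s (s≤s z≤n)) , vertex p , edge , vertex-injective p , joins , onCycle , ∈C)
      , C⊆ , h∈C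
    where
    edge : Fin (suc (suc (suc k))) → Edge
    edge = edgeClosedBy p h

    C : EdgeSet G
    C = subsetOf (λ x → Fin.any? (λ t → edge t ≟ x))

    onCycle : ∀ g → g ∈ C → ∃[ t ] edge t ≡ g
    onCycle g = ∈subsetOf⁻ _

    ∈C : ∀ t → edge t ∈ C
    ∈C t = ∈subsetOf⁺ _ (t , refl)

    joins : ∀ t → Joins G (edge t) (vertex p t) (vertex p (cycSuc G t))
    joins t with fromℕ-or-inject₁ t
    ... | inj₁ refl
      rewrite edgeClosedBy-last p h | vertex-last p | cycSuc-fromℕ (suc (suc k)) | vertex-first p = jh
    ... | inj₂ (t′ , refl) rewrite cycSuc-inject₁ t′ = edgeClosedBy-joins p h t′

    C⊆ : ∀ x → x ∈ C → P x ⊎ x ≡ h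
    C⊆ x x∈C with onCycle x x∈C
    ... | t , refl = edgeClosedBy-pred p h t

    h∈C : h ∈ C
    h∈C = subst (_∈ C) (edgeClosedBy-last p h) (∈C (fromℕ (suc (suc k))))

  -- Simplicity of G is what makes the path between the ends of h (avoiding h) have at least two edges.
  fundamentalCycle : ∀ {P : Edge → Set} h → ¬ P h → Walk P (end₁ h) (end₂ h) → CycleThrough P h
  fundamentalCycle {P} h ¬ph w = close refl refl (proj₂ (walk⇒path w))
    where
    close : ∀ {a b k} → a ≡ end₁ h → b ≡ end₂ h → Path P a b k → CycleThrough P h
    close refl eq []                              = ⊥-elim (noLoop h eq)
    close refl refl (cons g pg j [] _)            = ⊥-elim (¬ph (subst P (noMulti g h j) pg))
    close refl refl p@(cons _ _ _ (cons _ _ _ _ _) _) = closePath p h (Joins-sym (joins-ends h))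

  module CycleAround {k : ℕ} (k≥2 : 3 ℕ.≤ suc k) (v : Fin (suc k) → Vertex) (e : Fin (suc k) → Edge)
                     (v-injective : Injective _≡_ _≡_ v)
                     (joins : ∀ t → Joins G (e t) (v t) (v (cycSuc G t))) where

    K : ℕ
    K = suc k

    position : ℕ → Fin K
    position i = fromℕ< (m%n<n i K)

    position-cong : ∀ a b → a % K ≡ b % K → position a ≡ position b
    position-cong a b eq = Fin.toℕ-injective
      (trans (Fin.toℕ-fromℕ< (m%n<n a K)) (trans eq (sym (Fin.toℕ-fromℕ< (m%n<n b K)))))

    position-toℕ : ∀ t → position (toℕ t) ≡ t
    position-toℕ t = Fin.toℕ-injective (trans (Fin.toℕ-fromℕ< (m%n<n (toℕ t) K)) (m<n⇒m%n≡m (Fin.toℕ<n t)))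

    cycSuc-position : ∀ i → cycSuc G (position i) ≡ position (suc i)
    cycSuc-position i = position-cong (suc (toℕ (position i))) (suc i)
      (trans (cong (λ z → suc z % K) (Fin.toℕ-fromℕ< (m%n<n i K))) ([1+m%n]%n≡[1+m]%n i K))

    cycSuc²≢id : ∀ s → cycSuc G (cycSuc G s) ≢ s
    cycSuc²≢id s eq = [m+o]%n≢m (toℕ s) 2 K (s≤s z≤n) k≥2 (begin
      (toℕ s + 2) % K             ≡⟨ cong (_% K) (ℕ.+-comm (toℕ s) 2) ⟩
      suc (suc (toℕ s)) % K       ≡⟨ sym ([1+m%n]%n≡[1+m]%n (suc (toℕ s)) K) ⟩
      suc (suc (toℕ s) % K) % K   ≡⟨ cong (λ z → suc z % K) (sym (Fin.toℕ-fromℕ< (m%n<n (suc (toℕ s)) K))) ⟩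
      suc (toℕ (cycSuc G s)) % K  ≡⟨ sym (Fin.toℕ-fromℕ< (m%n<n (suc (toℕ (cycSuc G s))) K)) ⟩
      toℕ (cycSuc G (cycSuc G s)) ≡⟨ cong toℕ eq ⟩
      toℕ s                       ∎)
      where open ≡-Reasoning

    -- Two cycle positions carrying the same edge would be consecutive in both directions.
    edge-injective : ∀ {a b} → e a ≡ e b → a ≡ b
    edge-injective {a} {b} eq with Joins-unique (subst (λ g → Joins G g (v a) (v (cycSuc G a))) eq (joins a)) (joins b)
    ... | inj₁ (va≡vb , _)  = v-injective va≡vb
    ... | inj₂ (va≡vb′ , va′≡vb) =
      ⊥-elim (cycSuc²≢id b (trans (cong (cycSuc G) (sym (v-injective va≡vb′))) (v-injective va′≡vb)))

    joins-position : ∀ i → Joins G (e (position i)) (v (position i)) (v (position (suc i)))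
    joins-position i = subst (λ t → Joins G (e (position i)) (v (position i)) (v t)) (cycSuc-position i) (joins (position i))

    walkAlong : ∀ {Q : Edge → Set} i d → (∀ s → i ℕ.≤ s → s ℕ.< i + d → Q (e (position s))) →
                Walk Q (v (position i)) (v (position (i + d)))
    walkAlong i zero    _ rewrite ℕ.+-identityʳ i = []
    walkAlong i (suc d) q rewrite ℕ.+-suc i d =
      snoc (walkAlong i d (λ s i≤s s<i+d → q s i≤s (ℕ.m<n⇒m<1+n s<i+d)))
           (e (position (i + d))) (q (i + d) (ℕ.m≤m+n i d) (ℕ.n<1+n (i + d))) (joins-position (i + d))

  aroundCycle : ∀ {C} {P : Edge → Set} → IsCycle G C → ∀ h → h ∈ C → (∀ x → x ∈ C → x ≢ h → P x) →
                Walk P (end₁ h) (end₂ h)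
  aroundCycle {C} {P} (k , k≥2 , v , e , v-injective , joins , onCycle , ∈C) h h∈C C-h⊆P with onCycle h h∈C
  ... | t , refl = alongEdge⁻ (Joins-sym (joins t))
                     (subst (Walk _ (v (cycSuc G t))) backToStart (walkAlong (suc (toℕ t)) k avoids))
    where
    open CycleAround k≥2 v e v-injective joins

    backToStart : v (position (suc (toℕ t) + k)) ≡ v t
    backToStart = cong v (trans (position-cong (suc (toℕ t) + k) (toℕ t)
                                   (trans (cong (_% K) (sym (ℕ.+-suc (toℕ t) k))) ([m+n]%n≡m%n (toℕ t) K)))
                                (position-toℕ t))

    avoids : ∀ s → suc (toℕ t) ℕ.≤ s → s ℕ.< suc (toℕ t) + k → P (e (position s))
    avoids s t<s s<t+K = C-h⊆P (e (position s)) (∈C (position s)) λ eq →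
      [m+o]%n≢m (toℕ t) (s ∸ toℕ t) K (ℕ.m<n⇒0<n∸m t<s) s-t<K (begin
      (toℕ t + (s ∸ toℕ t)) % K ≡⟨ cong (_% K) (ℕ.m+[n∸m]≡n (ℕ.<⇒≤ t<s)) ⟩
      s % K                     ≡⟨ sym (Fin.toℕ-fromℕ< (m%n<n s K)) ⟩
      toℕ (position s)          ≡⟨ cong toℕ (edge-injective eq) ⟩
      toℕ t                     ∎)
      where
      open ≡-Reasoning
      s-t<K : s ∸ toℕ t ℕ.< K
      s-t<K = subst (s ∸ toℕ t ℕ.<_) (ℕ.m+n∸m≡n (toℕ t) K)
                (ℕ.∸-monoˡ-< (subst (s ℕ.<_) (sym (ℕ.+-suc (toℕ t) k)) s<t+K) (ℕ.<⇒≤ t<s))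

  -- Spanning trees and edge exchange

  Cut : EdgeSet G → Edge → Edge → Set
  Cut T e g = ¬ Walk (_∈ T - e) (end₁ g) (end₂ g)

  cut? : ∀ T e → Decidable (Cut T e)
  cut? T e g = ¬? (walk? (_∈? (T - e)) (end₁ g) (end₂ g))

  inCut⇒cut : ∀ {T e g} → InCut G T e g → Cut T e g
  inCut⇒cut ¬r w = ¬r (walk⇒reach w)

  cut⇒inCut : ∀ {T e g} → Cut T e g → InCut G T e g
  cut⇒inCut ¬w r = ¬w (reach⇒walk r)

  separating⇒cut : ∀ {P : Edge → Set} {a w} → Separates (Walk P a) w → ¬ Walk P (end₁ w) (end₂ w)
  separating⇒cut (inj₁ (a⇝w₁ , ¬a⇝w₂)) w₁⇝w₂ = ¬a⇝w₂ (a⇝w₁ ++ w₁⇝w₂)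
  separating⇒cut (inj₂ (¬a⇝w₁ , a⇝w₂)) w₁⇝w₂ = ¬a⇝w₁ (a⇝w₂ ++ reverse w₁⇝w₂)

  treeEdge-inCut : ∀ {T e} → SpanningTree G T → e ∈ T → Cut T e e
  treeEdge-inCut {T} {e} st e∈T w with fundamentalCycle e (λ e∈T-e → x∈p-y⇒x≢y e∈T-e refl) w
  ... | C , cyc , C⊆ , _ = proj₂ st C cyc (λ {x} x∈C → [ x∈p-y⇒x∈p , (λ { refl → e∈T }) ]′ (C⊆ x x∈C))

  connected-⊆-spanningTree⇒⊇ : ∀ {S T} → ConnectedBy G S → SpanningTree G T → S ⊆ T → T ⊆ S
  connected-⊆-spanningTree⇒⊇ {S} {T} conn st S⊆T {y} y∈T with y ∈? S
  ... | yes y∈S = y∈S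
  ... | no  y∉S = ⊥-elim (treeEdge-inCut st y∈T (weaken S⊆T-y (reach⇒walk (conn (end₁ y) (end₂ y)))))
    where
    S⊆T-y : ∀ z → z ∈ S → z ∈ T - y
    S⊆T-y z z∈S = x∈p∧x≢y⇒x∈p-y (S⊆T z∈S) (λ { refl → y∉S z∈S })

  cycle⇒cut : ∀ {S C g x} → SpanningTree G S → IsCycle G C → (∀ y → y ∈ C → y ∈ S ⊎ y ≡ g) →
              x ∈ C → x ∈ S → x ≢ g → Cut S x g
  cycle⇒cut {S} {C} {g} {x} st cyc C⊆ x∈C x∈S x≢g w =
    treeEdge-inCut st x∈S (bypass g (λ _ → id) w (aroundCycle cyc x x∈C C-x⊆))
    where
    C-x⊆ : ∀ y → y ∈ C → y ≢ x → y ∈ S - x ⊎ y ≡ g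
    C-x⊆ y y∈C y≢x = [ (λ y∈S → inj₁ (x∈p∧x≢y⇒x∈p-y y∈S y≢x)) , inj₂ ]′ (C⊆ y y∈C)

  cut⇒onCycle : ∀ {T C h y} → IsCycle G C → h ∈ C → (∀ z → z ∈ C → z ≢ h → z ∈ T) → Cut T y h → y ∈ C
  cut⇒onCycle {T} {C} {h} {y} cyc h∈C C-h⊆T h∈cut with y ∈? C
  ... | yes y∈C = y∈C
  ... | no  y∉C = ⊥-elim (h∈cut (aroundCycle cyc h h∈C λ z z∈C z≢h →
                            x∈p∧x≢y⇒x∈p-y (C-h⊆T z z∈C z≢h) (λ { refl → y∉C z∈C })))

  cycle-⊆-∪⁅⁆ : ∀ {T C f} → SpanningTree G T → IsCycle G C → (∀ x → x ∈ C → x ∈ T ⊎ x ≡ f) →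
                f ∈ C × f ∉ T
  cycle-⊆-∪⁅⁆ {T} {C} {f} st cyc C⊆ = f∈C , λ f∈T → proj₂ st C cyc (⊆T (λ _ → f∈T))
    where
    ⊆T : (f ∈ C → f ∈ T) → C ⊆ T
    ⊆T f∈T {x} x∈C = [ id , (λ { refl → f∈T x∈C }) ]′ (C⊆ x x∈C)

    f∈C : f ∈ C
    f∈C with f ∈? C
    ... | yes f∈C = f∈C
    ... | no  f∉C = ⊥-elim (proj₂ st C cyc (⊆T (⊥-elim ∘ f∉C)))

  treeMinusEdge-sides : ∀ {T e} → SpanningTree G T → e ∈ T → ∀ v →
                        Walk (_∈ T - e) (end₁ e) v ⊎ Walk (_∈ T - e) (end₂ e) v
  treeMinusEdge-sides {T} {e} st e∈T v with splitAt e (λ _ → x∈p⇒x∈p-y⊎x≡y e) (reach⇒walk (proj₁ st (end₁ e) v))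
  ... | inj₁ w               = inj₁ w
  ... | inj₂ (inj₁ (_ , w)) = inj₂ w
  ... | inj₂ (inj₂ (_ , w)) = inj₁ w

  module _ {T : EdgeSet G} {e f : Edge} (st : SpanningTree G T) (e∈T : e ∈ T) (f∈cut : Cut T e f) where

    private
      T′ : EdgeSet G
      T′ = (T - e) ∪ ⁅ f ⁆

      ⊆T′ : ∀ x → x ∈ T - e → x ∈ T′
      ⊆T′ x = x∈p∪⁅y⁆⁺ ∘ inj₁

      f∈T′ : f ∈ T′
      f∈T′ = x∈p∪⁅y⁆⁺ (inj₂ refl)

      -- f crosses from the side of one end of e to the side of the other.
      detour : Walk (_∈ T′) (end₁ e) (end₂ e)
      detour with treeMinusEdge-sides st e∈T (end₁ f) | treeMinusEdge-sides st e∈T (end₂ f)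
      ... | inj₁ a | inj₁ b = ⊥-elim (f∈cut (reverse a ++ b))
      ... | inj₂ a | inj₂ b = ⊥-elim (f∈cut (reverse a ++ b))
      ... | inj₁ a | inj₂ b = weaken ⊆T′ a ++ cons f f∈T′ (joins-ends f) (reverse (weaken ⊆T′ b))
      ... | inj₂ a | inj₁ b = weaken ⊆T′ b ++ cons f f∈T′ (Joins-sym (joins-ends f)) (reverse (weaken ⊆T′ a))

    exchange-connected : ConnectedBy G T′
    exchange-connected u v = walk⇒reach (bypass e T⊆T′+e detour (reach⇒walk (proj₁ st u v)))
      where
      T⊆T′+e : ∀ g → g ∈ T → g ∈ T′ ⊎ g ≡ e
      T⊆T′+e g g∈T = [ inj₁ ∘ ⊆T′ g , inj₂ ]′ (x∈p⇒x∈p-y⊎x≡y e g∈T)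

    exchange-acyclic : ∀ C → IsCycle G C → ¬ (C ⊆ T′)
    exchange-acyclic C cyc C⊆T′ with f ∈? C
    ... | yes f∈C = f∈cut (aroundCycle cyc f f∈C λ x x∈C x≢f →
                      [ id , ⊥-elim ∘ x≢f ]′ (x∈p∪⁅y⁆⁻ (C⊆T′ x∈C)))
    ... | no  f∉C = proj₂ st C cyc λ {x} x∈C →
                      [ x∈p-y⇒x∈p , (λ { refl → ⊥-elim (f∉C x∈C) }) ]′ (x∈p∪⁅y⁆⁻ (C⊆T′ x∈C))

    exchange-spanningTree : SpanningTree G T′
    exchange-spanningTree = exchange-connected , exchange-acyclic

  -- ℛ(T) is the set of passive edges

  Passive : EdgeSet G → Edge → Set
  Passive T x = ∃[ h ] (Cut T x h × h < x)

  active⇒¬passive : ∀ {T x} → (∀ h → Cut T x h → x ≤ h) → ¬ Passive T x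
  active⇒¬passive active (h , h∈cut , h<x) = Fin.<-irrefl refl (ℕ.<-≤-trans h<x (active h h∈cut))

  -- A broken circuit C - c inside the exchanged tree must contain g. Walking around C from g, the
  -- first edge w leaving the component of end₁ g in T - x lies in cut(T, x), so g ≤ w; hence w is
  -- not c < g, so w ∈ C - c, and w ≠ g puts w in T - x, contradicting w ∈ cut(T, x).
  exchange-nbc : ∀ {T x g} → SpanningTree G T → NBC G T → x ∈ T → Cut T x g → (∀ h → Cut T x h → g ≤ h) →
                 NBC G ((T - x) ∪ ⁅ g ⁆)
  exchange-nbc {T} {x} {g} st nbc x∈T g∈cut g-least B (C , c , cyc , c∈C , c-least , refl) B⊆ with g ∈? C
  ... | no g∉C = nbc B (C , c , cyc , c∈C , c-least , refl) λ {y} y∈B →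
                   [ x∈p-y⇒x∈p , (λ { refl → ⊥-elim (g∉C (x∈p-y⇒x∈p y∈B)) }) ]′ (x∈p∪⁅y⁆⁻ (B⊆ y∈B))
  ... | yes g∈C with c ≟ g
  ...   | yes refl = exchange-acyclic st x∈T g∈cut C cyc λ {y} y∈C →
                       [ B⊆ , (λ { refl → x∈p∪⁅y⁆⁺ (inj₂ refl) }) ]′ (x∈p⇒x∈p-y⊎x≡y c y∈C)
  ...   | no c≢g
    with exitEdge (Walk (_∈ T - x) (end₁ g)) (walk? (_∈? (T - x)) (end₁ g))
                  (aroundCycle cyc g g∈C (λ _ y∈C y≢g → y∈C , y≢g)) [] g∈cut
  ...     | w , (w∈C , w≢g) , separates with w ≟ c
  ...       | yes refl = Fin.<-irrefl refl
                           (ℕ.<-≤-trans (Fin.≤∧≢⇒< (c-least g g∈C) c≢g) (g-least w (separating⇒cut separates)))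
  ...       | no  w≢c  = [ separating⇒cut separates ∘ edgeWalk w , w≢g ]′
                           (x∈p∪⁅y⁆⁻ (B⊆ (x∈p∧x≢y⇒x∈p-y w∈C w≢c)))

  -- Exchanging x for the least edge of its cut gives an earlier NBC tree containing T - x.
  passive⇒ℛ : ∀ {T x} → NBCSpanningTree G T → x ∈ T → Passive T x → InR G T x
  passive⇒ℛ {T} {x} (st , nbc) x∈T (h , h∈cut , h<x) with leastWitness (cut? T x) (h , h∈cut)
  ... | g , g∈cut , g-least =
    x∈T , (T - x) ∪ ⁅ g ⁆ , (exchange-spanningTree st x∈T g∈cut , exchange-nbc st nbc x∈T g∈cut g-least)
        , exchange-<lex x∈T g∉T g<x , x∈p∪⁅y⁆⁺ ∘ inj₁
    where
    g<x : g < x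
    g<x = ℕ.≤-<-trans (g-least h h∈cut) h<x

    g∉T : g ∉ T
    g∉T g∈T = g∈cut (edgeWalk g (x∈p∧x≢y⇒x∈p-y g∈T (Fin.<⇒≢ g<x)))

  -- The first edge d where an earlier tree T″ ⊇ T - x differs from T lies in cut(T, x).
  ℛ⇒passive : ∀ {T x} → SpanningTree G T → InR G T x → Passive T x
  ℛ⇒passive {T} {x} st (x∈T , T″ , (st″ , _) , T″<T , T-x⊆T″) with <lex⇒lexDifference T″ T T″<T
  ... | inj₂ (T″⊆T , y , y∈T , y∉T″) = ⊥-elim (y∉T″ (connected-⊆-spanningTree⇒⊇ (proj₁ st″) st T″⊆T y∈T))
  ... | inj₁ (d , d∈T″ , d∉T , agree) = d , d∈cut , d<x
    where
    d∈cut : Cut T x d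
    d∈cut w = treeEdge-inCut st″ d∈T″ (weaken T-x⊆T″-d w)
      where
      T-x⊆T″-d : ∀ z → z ∈ T - x → z ∈ T″ - d
      T-x⊆T″-d z z∈T-x = x∈p∧x≢y⇒x∈p-y (T-x⊆T″ z∈T-x) (λ { refl → d∉T (x∈p-y⇒x∈p z∈T-x) })

    d<x : d < x
    d<x with Fin.<-cmp d x
    ... | tri< d<x _ _ = d<x
    ... | tri≈ _ refl _ = ⊥-elim (d∉T x∈T)
    ... | tri> _ _ x<d = ⊥-elim (d∉T (connected-⊆-spanningTree⇒⊇ (proj₁ st) st″ T⊆T″ d∈T″))
      where
      T⊆T″ : T ⊆ T″
      T⊆T″ {z} z∈T = [ T-x⊆T″ , (λ { refl → proj₂ (agree x x<d) x∈T }) ]′ (x∈p⇒x∈p-y⊎x≡y x z∈T)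

  -- The setting of the theorem, after locating the first edge g where T and T′ differ.
  module IntervalStep {T T′ : EdgeSet G} (nbc : NBCSpanningTree G T) (nbc′ : NBCSpanningTree G T′)
                      (T<T′ : _<lex_ G T T′) (f : Edge)
                      (ℛ′⊆ℛ∪f : ∀ x → InR G T′ x → InR G T x ⊎ x ≡ f)
                      (ℛ∪f⊆T′ : ∀ x → InR G T x ⊎ x ≡ f → x ∈ T′)
                      {g : Edge} (g∈T : g ∈ T) (g∉T′ : g ∉ T′) (agree : AgreeBelow T T′ g) where

    private
      st : SpanningTree G T
      st = proj₁ nbc

      st′ : SpanningTree G T′
      st′ = proj₁ nbc′

    f∈T′ : f ∈ T′
    f∈T′ = ℛ∪f⊆T′ f (inj₂ refl)

    passive⇒∈T′ : ∀ {x} → x ∈ T → Passive T x → x ∈ T′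
    passive⇒∈T′ x∈T p = ℛ∪f⊆T′ _ (inj₁ (passive⇒ℛ nbc x∈T p))

    passive′⇒ℛ∪f : ∀ {x} → x ∈ T′ → Passive T′ x → InR G T x ⊎ x ≡ f
    passive′⇒ℛ∪f x∈T′ p = ℛ′⊆ℛ∪f _ (passive⇒ℛ nbc′ x∈T′ p)

    -- Passive edges of T are in ℛ(T) ⊆ T′.
    ∉T′⇒active : ∀ {x} → x ∈ T → x ∉ T′ → ∀ h → Cut T x h → x ≤ h
    ∉T′⇒active x∈T x∉T′ h h∈cut = ℕ.≮⇒≥ λ h<x → x∉T′ (passive⇒∈T′ x∈T (h , h∈cut , h<x))

    g<new : ∀ {x} → x ∈ T′ → x ∉ T → g < x
    g<new {x} x∈T′ x∉T with Fin.<-cmp x g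
    ... | tri< x<g _ _  = ⊥-elim (x∉T (proj₂ (agree x x<g) x∈T′))
    ... | tri≈ _ refl _ = ⊥-elim (g∉T′ x∈T′)
    ... | tri> _ _ g<x  = g<x

    C-cycle : CycleThrough (_∈ T′) g
    C-cycle = fundamentalCycle g g∉T′ (reach⇒walk (proj₁ st′ (end₁ g) (end₂ g)))

    C : EdgeSet G
    C = proj₁ C-cycle

    cyc : IsCycle G C
    cyc = proj₁ (proj₂ C-cycle)

    C⊆T′+g : ∀ x → x ∈ C → x ∈ T′ ⊎ x ≡ g
    C⊆T′+g = proj₁ (proj₂ (proj₂ C-cycle))

    g∈C : g ∈ C
    g∈C = proj₂ (proj₂ (proj₂ C-cycle))

    -- An edge of C outside T is passive in T′ (g < x lies in its cut), so it is in ℛ(T) ∪ {f} ⊆ T ∪ {f}.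
    C⊆T+f : ∀ x → x ∈ C → x ∈ T ⊎ x ≡ f
    C⊆T+f x x∈C with x ∈? T
    ... | yes x∈T = inj₁ x∈T
    ... | no  x∉T with C⊆T′+g x x∈C
    ...   | inj₂ refl = ⊥-elim (x∉T g∈T)
    ...   | inj₁ x∈T′ = [ ⊥-elim ∘ x∉T ∘ proj₁ , inj₂ ]′ (passive′⇒ℛ∪f x∈T′ (g , g∈cut , g<new x∈T′ x∉T))
      where
      g∈cut : Cut T′ x g
      g∈cut = cycle⇒cut st′ cyc C⊆T′+g x∈C x∈T′ (λ { refl → x∉T g∈T })

    f∈C : f ∈ C
    f∈C = proj₁ (cycle-⊆-∪⁅⁆ st cyc C⊆T+f)

    f∉T : f ∉ T
    f∉T = proj₂ (cycle-⊆-∪⁅⁆ st cyc C⊆T+f)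

    C-f⊆T : ∀ x → x ∈ C → x ≢ f → x ∈ T
    C-f⊆T x x∈C x≢f = [ id , ⊥-elim ∘ x≢f ]′ (C⊆T+f x x∈C)

    f∈cut[g] : Cut T g f
    f∈cut[g] = cycle⇒cut st cyc C⊆T+f g∈C g∈T (λ { refl → f∉T g∈T })

    g-active : InternallyActive G T g
    g-active = g∈T , λ h h∈cut → ∉T′⇒active g∈T g∉T′ h (inCut⇒cut h∈cut)

    -- If y ∈ T ∖ T′ then, walking around the fundamental cycle of y in T′, some edge w ∈ T′ ∖ T
    -- crosses cut(T, y); y is active, so y < w and w is passive in T′, forcing w = f.
    T∖T′⇒f∈cut : ∀ {y} → y ∈ T → y ∉ T′ → Cut T y f
    T∖T′⇒f∈cut {y} y∈T y∉T′ f-ends with fundamentalCycle y y∉T′ (reach⇒walk (proj₁ st′ (end₁ y) (end₂ y)))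
    ... | D , cycD , D⊆T′+y , y∈D
      with exitEdge (Walk (_∈ T - y) (end₁ y)) (walk? (_∈? (T - y)) (end₁ y))
                    (aroundCycle cycD y y∈D (λ _ x∈D x≢y → x∈D , x≢y)) [] (treeEdge-inCut st y∈T)
    ... | w , (w∈D , w≢y) , separates =
      [ (λ w∈ℛ → w∉T (proj₁ w∈ℛ)) , (λ { refl → w∈cut f-ends }) ]′ (passive′⇒ℛ∪f w∈T′ (y , y∈cut′ , y<w))
      where
      w∈cut : Cut T y w
      w∈cut = separating⇒cut separates

      w∈T′ : w ∈ T′
      w∈T′ = [ id , ⊥-elim ∘ w≢y ]′ (D⊆T′+y w w∈D)

      w∉T : w ∉ T
      w∉T w∈T = w∈cut (edgeWalk w (x∈p∧x≢y⇒x∈p-y w∈T w≢y))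

      y<w : y < w
      y<w = Fin.≤∧≢⇒< (∉T′⇒active y∈T y∉T′ w w∈cut) (w≢y ∘ sym)

      y∈cut′ : Cut T′ w y
      y∈cut′ = cycle⇒cut st′ cycD D⊆T′+y w∈D w∈T′ w≢y

    T-g⊆T′ : T - g ⊆ T′
    T-g⊆T′ {y} y∈T-g with y ∈? T′
    ... | yes y∈T′ = y∈T′
    ... | no  y∉T′ = [ id , ⊥-elim ∘ x∈p-y⇒x≢y y∈T-g ]′
                       (C⊆T′+g y (cut⇒onCycle cyc f∈C C-f⊆T (T∖T′⇒f∈cut (x∈p-y⇒x∈p y∈T-g) y∉T′)))

    T′≡exchange : T′ ≡ (T - g) ∪ ⁅ f ⁆
    T′≡exchange = ⊆-antisym
      (connected-⊆-spanningTree⇒⊇ (exchange-connected st g∈T f∈cut[g]) st′ exchange⊆T′) exchange⊆T′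
      where
      exchange⊆T′ : (T - g) ∪ ⁅ f ⁆ ⊆ T′
      exchange⊆T′ x∈ = [ T-g⊆T′ , (λ { refl → f∈T′ }) ]′ (x∈p∪⁅y⁆⁻ x∈)

    T′-x⊆T-x+f : ∀ {x} z → z ∈ T′ - x → z ∈ T - x ⊎ z ≡ f
    T′-x⊆T-x+f z z∈T′-x with x∈p∪⁅y⁆⁻ (subst (z ∈_) T′≡exchange (x∈p-y⇒x∈p z∈T′-x))
    ... | inj₁ z∈T-g = inj₁ (x∈p∧x≢y⇒x∈p-y (x∈p-y⇒x∈p z∈T-g) (x∈p-y⇒x≢y z∈T′-x))
    ... | inj₂ z≡f   = inj₂ z≡f

    -- An active edge e′ > g of C would be passive in T′ (g ∈ cut(T′, e′)), hence in ℛ(T) ∪ {f}.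
    g-maximal : ∀ e′ → e′ ∈ C → InternallyActive G T e′ → e′ ≤ g
    g-maximal e′ e′∈C (e′∈T , e′-active) = ℕ.≮⇒≥ g≮e′
      where
      g≮e′ : ¬ g < e′
      g≮e′ g<e′ = [ active⇒¬passive (λ h → e′-active h ∘ cut⇒inCut) ∘ ℛ⇒passive st , (λ { refl → f∉T e′∈T }) ]′
                    (passive′⇒ℛ∪f e′∈T′ (g , cycle⇒cut st′ cyc C⊆T′+g e′∈C e′∈T′ e′≢g , g<e′))
        where
        e′≢g : e′ ≢ g
        e′≢g = Fin.<⇒≢ g<e′ ∘ sym

        e′∈T′ : e′ ∈ T′
        e′∈T′ = T-g⊆T′ (x∈p∧x≢y⇒x∈p-y e′∈T e′≢g)

    f∈ℛ′ : InR G T′ f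
    f∈ℛ′ = f∈T′ , T , nbc , T<T′ , λ z∈T′-f →
             [ x∈p-y⇒x∈p , ⊥-elim ∘ x∈p-y⇒x≢y z∈T′-f ]′ (T′-x⊆T-x+f _ z∈T′-f)

    ℛ⊆T′ : ∀ {x} → InR G T x → x ∈ T′
    ℛ⊆T′ x∈ℛ = ℛ∪f⊆T′ _ (inj₁ x∈ℛ)

    -- h < g is not in cut(T, g), since g is internally active.
    walk-below-g : ∀ {h} → h < g → Walk (_∈ T - g) (end₁ h) (end₂ h)
    walk-below-g {h} h<g with walk? (_∈? (T - g)) (end₁ h) (end₂ h)
    ... | yes w          = w
    ... | no  h∈cut[g] = ⊥-elim (active⇒¬passive (∉T′⇒active g∈T g∉T′) (h , h∈cut[g] , h<g))

    -- Below g the fundamental cycle of h in T - g carries h ∈ cut(T, x) over to T′.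
    cut-below-g : ∀ {x h} → x ∈ T′ → h < x → x < g → Cut T x h → Cut T′ x h
    cut-below-g {x} {h} x∈T′ h<x x<g h∈cut with fundamentalCycle h h∉T-g (walk-below-g (Fin.<-trans h<x x<g))
      where
      h∉T-g : h ∉ T - g
      h∉T-g h∈T-g = h∈cut (edgeWalk h (x∈p∧x≢y⇒x∈p-y (x∈p-y⇒x∈p h∈T-g) (Fin.<⇒≢ h<x)))
    ... | D , cycD , D⊆T-g+h , h∈D = cycle⇒cut st′ cycD D⊆T′+h x∈D x∈T′ (Fin.<⇒≢ h<x ∘ sym)
      where
      D⊆T′+h : ∀ z → z ∈ D → z ∈ T′ ⊎ z ≡ h
      D⊆T′+h z z∈D = [ inj₁ ∘ T-g⊆T′ , inj₂ ]′ (D⊆T-g+h z z∈D)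

      x∈D : x ∈ D
      x∈D = cut⇒onCycle cycD h∈D (λ z z∈D z≢h → x∈p-y⇒x∈p ([ id , ⊥-elim ∘ z≢h ]′ (D⊆T-g+h z z∈D))) h∈cut

    ℛ⇒passive′ : ∀ {x} → InR G T x → Passive T′ x
    ℛ⇒passive′ {x} x∈ℛ with ℛ⇒passive st x∈ℛ | walk? (_∈? (T - x)) (end₁ f) (end₂ f)
    ... | h , h∈cut , h<x | yes f-ends = h , (λ w → h∈cut (bypass f T′-x⊆T-x+f f-ends w)) , h<x
    ... | h , h∈cut , h<x | no  f∈cut with Fin.<-cmp g x
    ...   | tri< g<x _ _  =
      g , cycle⇒cut st′ cyc C⊆T′+g (cut⇒onCycle cyc f∈C C-f⊆T f∈cut) (ℛ⊆T′ x∈ℛ) (Fin.<⇒≢ g<x ∘ sym) , g<x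
    ...   | tri≈ _ refl _ = ⊥-elim (g∉T′ (ℛ⊆T′ x∈ℛ))
    ...   | tri> _ _ x<g  = h , cut-below-g (ℛ⊆T′ x∈ℛ) h<x x<g h∈cut , h<x

    ℛ∪f⊆ℛ′ : ∀ x → InR G T x ⊎ x ≡ f → InR G T′ x
    ℛ∪f⊆ℛ′ x (inj₁ x∈ℛ) = passive⇒ℛ nbc′ (ℛ⊆T′ x∈ℛ) (ℛ⇒passive′ x∈ℛ)
    ℛ∪f⊆ℛ′ x (inj₂ refl) = f∈ℛ′

proposition3p11 : (G : SimpleGraph) → Connected G →
    (Ti Tj : EdgeSet G) → NBCSpanningTree G Ti → NBCSpanningTree G Tj →
    _<lex_ G Ti Tj →
    (f : Fin (SimpleGraph.m G)) →
    InInterval G (_∪₁_ G (ℛ G Ti) f) (ℛ G Tj) Tj →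
    (∃[ C ] ∃[ e ] (IsCycle G C × C ⊆ (Ti ∪ ⁅ f ⁆)
        × e ∈ C × InternallyActive G Ti e
        × (∀ e′ → e′ ∈ C → InternallyActive G Ti e′ → e′ Fin.≤ e)
        × Tj ≡ ((Ti - e) ∪ ⁅ f ⁆)))
    × _≐_ G (_∪₁_ G (ℛ G Ti) f) (ℛ G Tj)
proposition3p11 G _ Ti Tj nbcᵢ nbcⱼ Ti<Tj f (ℛⱼ⊆ℛᵢ∪f , ℛᵢ∪f⊆Tj) with <lex⇒lexDifference Ti Tj Ti<Tj
... | inj₂ (Ti⊆Tj , y , y∈Tj , y∉Ti) =
  ⊥-elim (y∉Ti (connected-⊆-spanningTree⇒⊇ (proj₁ (proj₁ nbcᵢ)) (proj₁ nbcⱼ) Ti⊆Tj y∈Tj))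
  where open Graph G
... | inj₁ (g , g∈Ti , g∉Tj , agree) =
  (C , g , cyc , x∈p∪⁅y⁆⁺ ∘ C⊆T+f _ , g∈C , g-active , g-maximal , T′≡exchange)
  , λ x → ℛ∪f⊆ℛ′ x , ℛⱼ⊆ℛᵢ∪f x
  where open Graph G
        open IntervalStep nbcᵢ nbcⱼ Ti<Tj f ℛⱼ⊆ℛᵢ∪f ℛᵢ∪f⊆Tj g∈Ti g∉Tj agree
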